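{- Let $G$ and $H$ be graphs on $n$ vertices with connected components $G=G_1\cup\cdots\cup G_r$ and $H=H_1\cup\cdots\cup H_s$, and let $d=\max\{\mathrm{diam}(G_i),\mathrm{diam}(H_j)\}$ be the maximum diameter of the connected components. Suppose there is an invertible matrix $S\in\mathbb{C}^{n\times n}$ and $d$ distinct non-zero values of $q$ such that $\mathcal{D}_q^G S = S\mathcal{D}_q^H$ for each of these values of $q$. Then $G$ and $H$ are cospectral for the generalized distance matrix, i.e., $\mathcal{D}_f^G S = S\mathcal{D}_f^H$ (so $\mathcal{D}_f^G$ and $\mathcal{D}_f^H$ have the same spectrum) for every function $f$.
   Context: $\mathrm{dist}(u,v)$ is the length of a shortest path between $u$ and $v$; the diameter of a connected graph is its largest distance. The exponential distance matrix $\mathcal{D}_q^G$ has $(u,v)$ entry $q^{\mathrm{dist}(u,v)}$ (so diagonal entries are $1$); the generalized distance matrix $\mathcal{D}_f^G$ has $(u,v)$ entry $f(\mathrm{dist}(u,v))$. For vertices in different components the distance is $\infty$, and the corresponding entries are taken to be $0$ (i.e., $q^{\infty}=0$ and $f(\infty)=0$). Two graphs are cospectral for a matrix representation if their matrices have the same multiset of eigenvalues. -}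

module Defs where

open import Level using (Level; _⊔_)
open import Data.Nat as ℕ using (ℕ; zero; suc)
open import Data.Fin using (Fin; zero; suc)
open import Data.Fin.Properties using (_≟_)
open import Data.Bool using (Bool; true; false; _∧_; _∨_; T)
open import Data.Maybe using (Maybe; just; nothing)
open import Data.Product using (Σ; ∃; _×_; _,_)
open import Relation.Nullary using (¬_; does)
open import Relation.Binary.PropositionalEquality using (_≡_)
open import Algebra.Bundles using (CommutativeRing)

record Field (c ℓ : Level) : Set (Level.suc (c ⊔ ℓ)) where
  field
    commutativeRing : CommutativeRing c ℓ
  open CommutativeRing commutativeRing public
  field
    0≉1     : ¬ (0# ≈ 1#)
    inverse : ∀ x → ¬ (x ≈ 0#) → Σ Carrier λ y → x * y ≈ 1#

record Graph (n : ℕ) : Set where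
  field
    adj       : Fin n → Fin n → Bool
    symmetric : ∀ u v → adj u v ≡ adj v u
    irreflexive : ∀ u → adj u u ≡ false

open Graph public

anyFin : ∀ {n} → (Fin n → Bool) → Bool
anyFin {zero}  p = false
anyFin {suc n} p = p zero ∨ anyFin (λ i → p (suc i))

walk : ∀ {n} → Graph n → ℕ → Fin n → Fin n → Bool
walk G zero    u v = does (u ≟ v)
walk G (suc k) u v = anyFin (λ w → adj G u w ∧ walk G k w v)

firstWalk : ∀ {n} → Graph n → Fin n → Fin n → ℕ → ℕ → Maybe ℕ
firstWalk G u v start zero = nothing
firstWalk G u v start (suc fuel) with walk G start u v
... | true  = just start
... | false = firstWalk G u v (suc start) fuel

-- dist G u v = just (length of a shortest path from u to v), or nothing (= ∞)
-- when u and v lie in different components.  A shortest walk is a path, and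
-- a path in a graph on n vertices has length < n, so searching k < n suffices.
dist : ∀ {n} → Graph n → Fin n → Fin n → Maybe ℕ
dist {n} G u v = firstWalk G u v 0 n

maxFin : ∀ {n} → (Fin n → ℕ) → ℕ
maxFin {zero}  f = 0
maxFin {suc n} f = f zero ℕ.⊔ maxFin (λ i → f (suc i))

finiteOr0 : Maybe ℕ → ℕ
finiteOr0 (just k) = k
finiteOr0 nothing  = 0

-- the maximum diameter of a connected component of G
-- = the largest finite distance between two vertices of G
maxComponentDiam : ∀ {n} → Graph n → ℕ
maxComponentDiam G = maxFin (λ u → maxFin (λ v → finiteOr0 (dist G u v)))

module Matrices {c ℓ} (F : Field c ℓ) where
  open Field F using (Carrier; _≈_; _+_; _*_; 0#; 1#)

  Matrix : ℕ → Set c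
  Matrix n = Fin n → Fin n → Carrier

  sumFin : ∀ {n} → (Fin n → Carrier) → Carrier
  sumFin {zero}  f = 0#
  sumFin {suc n} f = f zero + sumFin (λ i → f (suc i))

  _⊗_ : ∀ {n} → Matrix n → Matrix n → Matrix n
  (A ⊗ B) i j = sumFin (λ k → A i k * B k j)

  I : ∀ {n} → Matrix n
  I i j with does (i ≟ j)
  ... | true  = 1#
  ... | false = 0#

  _≋_ : ∀ {n} → Matrix n → Matrix n → Set ℓ
  A ≋ B = ∀ i j → A i j ≈ B i j

  Invertible : ∀ {n} → Matrix n → Set (c ⊔ ℓ)
  Invertible {n} S = Σ (Matrix n) λ T → (S ⊗ T) ≋ I × (T ⊗ S) ≋ I

  -- generalized distance matrix: entry f(dist(u,v)), with f(∞) = 0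
  Df : ∀ {n} → Graph n → (ℕ → Carrier) → Matrix n
  Df G f u v with dist G u v
  ... | just k  = f k
  ... | nothing = 0#

  pow : Carrier → ℕ → Carrier
  pow q zero    = 1#
  pow q (suc k) = q * pow q k

  Dq : ∀ {n} → Graph n → Carrier → Matrix n
  Dq G q = Df G (pow q)

{-# OPTIONS --safe #-}
module Submission where

-- Each entry of D_f^G S − S D_f^H is a linear functional Φ of the sequence f that reads only
-- f 0, …, f d.  Such a functional behaves like the polynomial P(q) = Φ(k ↦ q^k) of degree ≤ d,
-- so it vanishes once P vanishes at d + 1 distinct points: the d given values of q together with
-- q = 0, for which D_0 = I trivially intertwines.

open import Defs
open import Level using (Level)
open import Data.Nat using (ℕ; zero; suc; _⊔_; _≤_; _<_; s≤s)
open import Data.Nat.Properties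
  using (≤-trans; ≤-reflexive; n≤1+n; m≤m⊔n; m≤n⊔m; m<n⇒m<1+n; <-≤-trans; <-irrefl)
open import Data.Fin using (Fin; zero; suc)
open import Data.Fin.Properties using (_≟_; suc-injective)
open import Data.Maybe using (just; nothing)
open import Data.Maybe.Properties using (just-injective)
open import Data.Bool using (true; false)
open import Data.Empty using (⊥-elim)
open import Data.Product using (_,_)
open import Data.Vec.Functional using (_∷_)
open import Function.Definitions using (Injective)
open import Relation.Nullary using (¬_; yes; no)
open import Relation.Binary.PropositionalEquality as ≡ using (_≡_; cong; subst)
import Algebra.Properties.Group as GroupProperties
import Algebra.Properties.CommutativeSemigroup as CommutativeSemigroupProperties
import Algebra.Properties.Semiring.Sum as SemiringSum

maxFin-≤ : ∀ {n} (f : Fin n → ℕ) i → f i ≤ maxFin f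
maxFin-≤ f zero    = m≤m⊔n _ _
maxFin-≤ f (suc i) = ≤-trans (maxFin-≤ (λ i → f (suc i)) i) (m≤n⊔m _ _)

dist≤maxComponentDiam : ∀ {n} (G : Graph n) {u v k} → dist G u v ≡ just k → k ≤ maxComponentDiam G
dist≤maxComponentDiam G {u} {v} d≡k = ≤-trans k≤eccentricity (maxFin-≤ eccentricity u)
  where
  eccentricity : _ → ℕ
  eccentricity u = maxFin (λ v → finiteOr0 (dist G u v))
  k≤eccentricity : _ ≤ eccentricity u
  k≤eccentricity = subst (_≤ eccentricity u) (cong finiteOr0 d≡k) (maxFin-≤ _ v)

firstWalk-start≤ : ∀ {n} (G : Graph n) {u v} start fuel {k} →
                   firstWalk G u v start fuel ≡ just k → start ≤ k
firstWalk-start≤ G {u} {v} start (suc fuel) found with walk G start u v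
... | true  = ≤-reflexive (just-injective found)
... | false = ≤-trans (n≤1+n start) (firstWalk-start≤ G (suc start) fuel found)

module Sequences {c ℓ} (F : Field c ℓ) where
  open Field F hiding (zero)
  open Matrices F using (pow)
  open import Relation.Binary.Reasoning.Setoid setoid
  open GroupProperties +-group using (∙-cancelˡ; x∙y⁻¹≈ε⇒x≈y; //-rightDividesˡ)
  open SemiringSum semiring using (sum; sum-cong-≋; ∑-distrib-+; *-distribˡ-sum)
  open CommutativeSemigroupProperties *-commutativeSemigroup using (x∙yz≈y∙xz)
  open import Algebra.Solver.Ring.NaturalCoefficients.Default commutativeSemiring
    using (solve; _:=_; _:+_; _:*_)

  Seq : Set c
  Seq = ℕ → Carrier

  _⊕_ : Seq → Seq → Seq
  (w ⊕ w′) k = w k + w′ k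

  _·_ : Carrier → Seq → Seq
  (a · w) k = a * w k

  record IsLinearOnPrefix (D : ℕ) (Φ : Seq → Carrier) : Set (c Level.⊔ ℓ) where
    field
      prefix-cong : ∀ {w w′} → (∀ k → k < D → w k ≈ w′ k) → Φ w ≈ Φ w′
      +-homo      : ∀ w w′ → Φ (w ⊕ w′) ≈ Φ w + Φ w′
      ·-homo      : ∀ a w → Φ (a · w) ≈ a * Φ w

  open IsLinearOnPrefix public

  isLinearOnPrefix-resp : ∀ {D Φ Ψ} → (∀ w → Φ w ≈ Ψ w) →
                          IsLinearOnPrefix D Φ → IsLinearOnPrefix D Ψ
  isLinearOnPrefix-resp Φ≈Ψ Φ-lin = record
    { prefix-cong = λ {w} {w′} w≈w′ → trans (sym (Φ≈Ψ w)) (trans (prefix-cong Φ-lin w≈w′) (Φ≈Ψ w′))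
    ; +-homo      = λ w w′ → trans (sym (Φ≈Ψ _)) (trans (+-homo Φ-lin w w′) (+-cong (Φ≈Ψ w) (Φ≈Ψ w′)))
    ; ·-homo      = λ a w → trans (sym (Φ≈Ψ _)) (trans (·-homo Φ-lin a w) (*-congˡ (Φ≈Ψ w)))
    }

  isLinearOnPrefix-mono : ∀ {m n Φ} → m ≤ n → IsLinearOnPrefix m Φ → IsLinearOnPrefix n Φ
  isLinearOnPrefix-mono m≤n Φ-lin = record
    { prefix-cong = λ w≈w′ → prefix-cong Φ-lin (λ k k<m → w≈w′ k (<-≤-trans k<m m≤n))
    ; +-homo      = +-homo Φ-lin
    ; ·-homo      = ·-homo Φ-lin
    }

  *ʳ-isLinearOnPrefix : ∀ {D Φ} → IsLinearOnPrefix D Φ → ∀ x → IsLinearOnPrefix D (λ w → Φ w * x)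
  *ʳ-isLinearOnPrefix Φ-lin x = record
    { prefix-cong = λ w≈w′ → *-congʳ (prefix-cong Φ-lin w≈w′)
    ; +-homo      = λ w w′ → trans (*-congʳ (+-homo Φ-lin w w′)) (distribʳ x _ _)
    ; ·-homo      = λ a w → trans (*-congʳ (·-homo Φ-lin a w)) (*-assoc a _ x)
    }

  *ˡ-isLinearOnPrefix : ∀ {D Φ} x → IsLinearOnPrefix D Φ → IsLinearOnPrefix D (λ w → x * Φ w)
  *ˡ-isLinearOnPrefix {Φ = Φ} x Φ-lin = record
    { prefix-cong = λ w≈w′ → *-congˡ (prefix-cong Φ-lin w≈w′)
    ; +-homo      = λ w w′ → trans (*-congˡ (+-homo Φ-lin w w′)) (distribˡ x _ _)
    ; ·-homo      = λ a w → trans (*-congˡ (·-homo Φ-lin a w)) (x∙yz≈y∙xz x a (Φ w))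
    }

  sum-isLinearOnPrefix : ∀ {D n} {Φ : Fin n → Seq → Carrier} → (∀ k → IsLinearOnPrefix D (Φ k)) →
                         IsLinearOnPrefix D (λ w → sum (λ k → Φ k w))
  sum-isLinearOnPrefix {Φ = Φ} Φ-lin = record
    { prefix-cong = λ w≈w′ → sum-cong-≋ (λ k → prefix-cong (Φ-lin k) w≈w′)
    ; +-homo      = λ w w′ → trans (sum-cong-≋ (λ k → +-homo (Φ-lin k) w w′))
                                   (∑-distrib-+ (λ k → Φ k w) (λ k → Φ k w′))
    ; ·-homo      = λ a w → trans (sum-cong-≋ (λ k → ·-homo (Φ-lin k) a w))
                                  (sym (*-distribˡ-sum a (λ k → Φ k w)))
    }

  *-cancelˡ-≉0 : ∀ {a} x y → ¬ (a ≈ 0#) → a * x ≈ a * y → x ≈ y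
  *-cancelˡ-≉0 {a} x y a≉0 ax≈ay with inverse a a≉0
  ... | b , ab≈1 = begin
    x            ≈⟨ *-identityˡ x ⟨
    1# * x       ≈⟨ *-congʳ ba≈1 ⟨
    b * a * x    ≈⟨ *-assoc b a x ⟩
    b * (a * x)  ≈⟨ *-congˡ ax≈ay ⟩
    b * (a * y)  ≈⟨ *-assoc b a y ⟨
    b * a * y    ≈⟨ *-congʳ ba≈1 ⟩
    1# * y       ≈⟨ *-identityˡ y ⟩
    y            ∎
    where
    ba≈1 : b * a ≈ 1#
    ba≈1 = trans (*-comm b a) ab≈1

  -- As power series geomShift r w = x w / (1 − r x); hence Φ ∘ geomShift r sends (q^k)ₖ to the
  -- divided difference (P(q) − P(r)) / (q − r), see pow-split.
  geomShift : Carrier → Seq → Seq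
  geomShift r w zero    = 0#
  geomShift r w (suc k) = w k + r * geomShift r w k

  geomShift-prefix-cong : ∀ r {m w w′} → (∀ k → k < m → w k ≈ w′ k) →
                          ∀ k → k < suc m → geomShift r w k ≈ geomShift r w′ k
  geomShift-prefix-cong r w≈w′ zero    _         = refl
  geomShift-prefix-cong r w≈w′ (suc k) (s≤s k<m) =
    +-cong (w≈w′ k k<m) (*-congˡ (geomShift-prefix-cong r w≈w′ k (m<n⇒m<1+n k<m)))

  geomShift-⊕ : ∀ r w w′ k → geomShift r (w ⊕ w′) k ≈ (geomShift r w ⊕ geomShift r w′) k
  geomShift-⊕ r w w′ zero    = sym (+-identityʳ 0#)
  geomShift-⊕ r w w′ (suc k) = begin
    (w k + w′ k) + r * geomShift r (w ⊕ w′) k    ≈⟨ +-congˡ (*-congˡ (geomShift-⊕ r w w′ k)) ⟩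
    (w k + w′ k) + r * (g + g′)
      ≈⟨ solve 5 (λ x x′ r g g′ → (x :+ x′) :+ r :* (g :+ g′) := (x :+ r :* g) :+ (x′ :+ r :* g′))
           refl (w k) (w′ k) r g g′ ⟩
    (w k + r * g) + (w′ k + r * g′)              ∎
    where
    g g′ : Carrier
    g = geomShift r w k; g′ = geomShift r w′ k

  geomShift-· : ∀ r a w k → geomShift r (a · w) k ≈ (a · geomShift r w) k
  geomShift-· r a w zero    = sym (zeroʳ a)
  geomShift-· r a w (suc k) = begin
    a * w k + r * geomShift r (a · w) k   ≈⟨ +-congˡ (*-congˡ (geomShift-· r a w k)) ⟩
    a * w k + r * (a * g)
      ≈⟨ solve 4 (λ a x r g → a :* x :+ r :* (a :* g) := a :* (x :+ r :* g)) refl a (w k) r g ⟩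
    a * (w k + r * g)                     ∎
    where
    g : Carrier
    g = geomShift r w k

  geomShift-isLinearOnPrefix : ∀ r {m Φ} → IsLinearOnPrefix (suc m) Φ →
                               IsLinearOnPrefix m (λ w → Φ (geomShift r w))
  geomShift-isLinearOnPrefix r Φ-lin = record
    { prefix-cong = λ w≈w′ → prefix-cong Φ-lin (geomShift-prefix-cong r w≈w′)
    ; +-homo      = λ w w′ → trans (prefix-cong Φ-lin (λ k _ → geomShift-⊕ r w w′ k)) (+-homo Φ-lin _ _)
    ; ·-homo      = λ a w → trans (prefix-cong Φ-lin (λ k _ → geomShift-· r a w k)) (·-homo Φ-lin _ _)
    }

  pow-split : ∀ r s k → pow s k ≈ (pow r ⊕ ((s + - r) · geomShift r (pow s))) k
  pow-split r s zero    = sym (trans (+-congˡ (zeroʳ _)) (+-identityʳ 1#))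
  pow-split r s (suc k) = begin
    s * pow s k                              ≈⟨ *-congˡ (pow-split r s k) ⟩
    s * (p + d * g)                          ≈⟨ *-congʳ (//-rightDividesˡ r s) ⟨
    (d + r) * (p + d * g)
      ≈⟨ solve 4 (λ d r p g → (d :+ r) :* (p :+ d :* g) := r :* p :+ d :* ((p :+ d :* g) :+ r :* g))
           refl d r p g ⟩
    r * p + d * ((p + d * g) + r * g)        ≈⟨ +-congˡ (*-congˡ (+-congʳ (pow-split r s k))) ⟨
    r * p + d * (pow s k + r * g)            ∎
    where
    p d g : Carrier
    p = pow r k; d = s + - r; g = geomShift r (pow s) k

  geomUnshift : Carrier → Seq → Seq
  geomUnshift r u k = u (suc k) + - (r * u k)

  geomShift-decomposition : ∀ r u k → u k ≈ (geomShift r (geomUnshift r u) ⊕ (u 0 · pow r)) k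
  geomShift-decomposition r u zero    = sym (trans (+-identityˡ _) (*-identityʳ (u 0)))
  geomShift-decomposition r u (suc k) = begin
    a                                       ≈⟨ +-identityʳ a ⟨
    a + 0#                                  ≈⟨ +-congˡ (-‿inverseˡ (r * (g + u 0 * p))) ⟨
    a + (- (r * (g + u 0 * p)) + r * (g + u 0 * p))
      ≈⟨ solve 6 (λ a n r g x p → a :+ (n :+ r :* (g :+ x :* p)) := (a :+ n :+ r :* g) :+ x :* (r :* p))
           refl a (- (r * (g + u 0 * p))) r g (u 0) p ⟩
    (a + - (r * (g + u 0 * p)) + r * g) + u 0 * (r * p)
      ≈⟨ +-congʳ (+-congʳ (+-congˡ (-‿cong (*-congˡ (geomShift-decomposition r u k))))) ⟨
    (a + - (r * u k) + r * g) + u 0 * (r * p) ∎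
    where
    a p g : Carrier
    a = u (suc k); p = pow r k; g = geomShift r (geomUnshift r u) k

  homo-⊕· : ∀ {D Θ} → IsLinearOnPrefix D Θ → ∀ {u v a w} → (∀ k → u k ≈ (v ⊕ (a · w)) k) →
            Θ u ≈ Θ v + a * Θ w
  homo-⊕· Θ-lin u≈v+aw =
    trans (prefix-cong Θ-lin (λ k _ → u≈v+aw k)) (trans (+-homo Θ-lin _ _) (+-congˡ (·-homo Θ-lin _ _)))

  injective-∷ : ∀ {D x} {qs : Fin D → Carrier} → (∀ i → ¬ (qs i ≈ x)) →
                Injective _≡_ _≈_ qs → Injective _≡_ _≈_ (x ∷ qs)
  injective-∷ qs≉x qs-inj {zero}  {zero}  _ = ≡.refl
  injective-∷ qs≉x qs-inj {zero}  {suc j} e = ⊥-elim (qs≉x j (sym e))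
  injective-∷ qs≉x qs-inj {suc i} {zero}  e = ⊥-elim (qs≉x i e)
  injective-∷ qs≉x qs-inj {suc i} {suc j} e = ≡.cong suc (qs-inj e)

  agree-on-powers⇒agree : ∀ D {qs : Fin D → Carrier} → Injective _≡_ _≈_ qs →
    ∀ {Φ Ψ} → IsLinearOnPrefix D Φ → IsLinearOnPrefix D Ψ →
    (∀ i → Φ (pow (qs i)) ≈ Ψ (pow (qs i))) → ∀ w → Φ w ≈ Ψ w
  agree-on-powers⇒agree zero _ Φ-lin Ψ-lin _ w = trans (vanishes Φ-lin) (sym (vanishes Ψ-lin))
    where
    vanishes : ∀ {Θ} → IsLinearOnPrefix 0 Θ → Θ w ≈ 0#
    vanishes {Θ} Θ-lin = begin
      Θ w         ≈⟨ prefix-cong Θ-lin (λ _ ()) ⟩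
      Θ (0# · w)  ≈⟨ ·-homo Θ-lin 0# w ⟩
      0# * Θ w    ≈⟨ zeroˡ _ ⟩
      0#          ∎
  agree-on-powers⇒agree (suc m) {qs} qs-inj {Φ} {Ψ} Φ-lin Ψ-lin Φ≈Ψ u = begin
    Φ u                                  ≈⟨ homo-⊕· Φ-lin (geomShift-decomposition r u) ⟩
    Φ (geomShift r w) + u 0 * Φ (pow r)  ≈⟨ +-cong (shifted-agree w) (*-congˡ (Φ≈Ψ zero)) ⟩
    Ψ (geomShift r w) + u 0 * Ψ (pow r)  ≈⟨ homo-⊕· Ψ-lin (geomShift-decomposition r u) ⟨
    Ψ u                                  ∎
    where
    r : Carrier
    r = qs zero
    w : Seq
    w = geomUnshift r u

    shifted-agree-on-powers : ∀ i → Φ (geomShift r (pow (qs (suc i)))) ≈ Ψ (geomShift r (pow (qs (suc i))))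
    shifted-agree-on-powers i = *-cancelˡ-≉0 _ _ s-r≉0 (∙-cancelˡ (Φ (pow r)) _ _ (begin
      Φ (pow r) + (s + - r) * Φ (geomShift r (pow s))  ≈⟨ homo-⊕· Φ-lin (pow-split r s) ⟨
      Φ (pow s)                                        ≈⟨ Φ≈Ψ (suc i) ⟩
      Ψ (pow s)                                        ≈⟨ homo-⊕· Ψ-lin (pow-split r s) ⟩
      Ψ (pow r) + (s + - r) * Ψ (geomShift r (pow s))  ≈⟨ +-congʳ (Φ≈Ψ zero) ⟨
      Φ (pow r) + (s + - r) * Ψ (geomShift r (pow s))  ∎))
      where
      s : Carrier
      s = qs (suc i)
      s-r≉0 : ¬ (s + - r ≈ 0#)
      s-r≉0 s-r≈0 with qs-inj (x∙y⁻¹≈ε⇒x≈y s r s-r≈0)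
      ... | ()

    shifted-agree : ∀ w → Φ (geomShift r w) ≈ Ψ (geomShift r w)
    shifted-agree = agree-on-powers⇒agree m (λ e → suc-injective (qs-inj e))
      (geomShift-isLinearOnPrefix r Φ-lin) (geomShift-isLinearOnPrefix r Ψ-lin) shifted-agree-on-powers

module DistanceMatrices {c ℓ} (F : Field c ℓ) where
  open Field F hiding (zero)
  open Matrices F
  open Sequences F
  open SemiringSum semiring using (sum; sum-cong-≋; sum-replicate-zero)
  open import Relation.Binary.Reasoning.Setoid setoid

  Df-isLinearOnPrefix : ∀ {n} (G : Graph n) u v →
                        IsLinearOnPrefix (suc (maxComponentDiam G)) (λ w → Df G w u v)
  Df-isLinearOnPrefix G u v with dist G u v in d≡
  ... | just k  = record
    { prefix-cong = λ w≈w′ → w≈w′ k (s≤s (dist≤maxComponentDiam G d≡))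
    ; +-homo      = λ _ _ → refl
    ; ·-homo      = λ _ _ → refl
    }
  ... | nothing = record
    { prefix-cong = λ _ → refl
    ; +-homo      = λ _ _ → sym (+-identityʳ 0#)
    ; ·-homo      = λ a _ → sym (zeroʳ a)
    }

  Dq-0#≋I : ∀ {n} (G : Graph n) → Dq G 0# ≋ I
  Dq-0#≋I {suc n} G u v with u ≟ v
  ... | yes _ = refl
  ... | no _  with firstWalk G u v 1 n in found
  ...   | just zero    = ⊥-elim (<-irrefl ≡.refl (firstWalk-start≤ G 1 n found))
  ...   | just (suc k) = zeroˡ _
  ...   | nothing      = refl

  I-suc : ∀ {n} (i j : Fin n) → I (suc i) (suc j) ≡ I i j
  I-suc i j with i ≟ j
  ... | yes _ = ≡.refl
  ... | no _  = ≡.refl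

  I-sym : ∀ {n} (i j : Fin n) → I i j ≡ I j i
  I-sym i j with i ≟ j | j ≟ i
  ... | yes _   | yes _   = ≡.refl
  ... | no _    | no _    = ≡.refl
  ... | yes i≡j | no j≢i  = ⊥-elim (j≢i (≡.sym i≡j))
  ... | no i≢j  | yes j≡i = ⊥-elim (i≢j (≡.sym j≡i))

  sumFin≡sum : ∀ {n} (f : Fin n → Carrier) → sumFin f ≡ sum f
  sumFin≡sum {zero}  f = ≡.refl
  sumFin≡sum {suc n} f = ≡.cong (f zero +_) (sumFin≡sum (λ k → f (suc k)))

  sumFin-cong : ∀ {n} {f g : Fin n → Carrier} → (∀ k → f k ≈ g k) → sumFin f ≈ sumFin g
  sumFin-cong {f = f} {g} f≈g rewrite sumFin≡sum f | sumFin≡sum g = sum-cong-≋ f≈g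

  sumFin-zero : ∀ {n} {f : Fin n → Carrier} → (∀ k → f k ≈ 0#) → sumFin f ≈ 0#
  sumFin-zero {n} {f} f≈0 rewrite sumFin≡sum f = trans (sum-cong-≋ f≈0) (sum-replicate-zero n)

  sum-I* : ∀ {n} (i : Fin n) (g : Fin n → Carrier) → sumFin (λ k → I i k * g k) ≈ g i
  sum-I* zero    g = begin
    1# * g zero + sumFin (λ k → 0# * g (suc k))
      ≈⟨ +-cong (*-identityˡ _) (sumFin-zero (λ k → zeroˡ (g (suc k)))) ⟩
    g zero + 0#                                  ≈⟨ +-identityʳ _ ⟩
    g zero                                       ∎
  sum-I* (suc i) g = begin
    0# * g zero + sumFin (λ k → I (suc i) (suc k) * g (suc k))
      ≈⟨ +-cong (zeroˡ _) (sumFin-cong (λ k → *-congʳ (reflexive (I-suc i k)))) ⟩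
    0# + sumFin (λ k → I i k * g (suc k))  ≈⟨ +-identityˡ _ ⟩
    sumFin (λ k → I i k * g (suc k))       ≈⟨ sum-I* i (λ k → g (suc k)) ⟩
    g (suc i)                              ∎

  sum-*I : ∀ {n} (j : Fin n) (g : Fin n → Carrier) → sumFin (λ k → g k * I k j) ≈ g j
  sum-*I j g = trans (sumFin-cong (λ k → trans (*-comm (g k) _) (*-congʳ (reflexive (I-sym k j))))) (sum-I* j g)

  Dq-0#-intertwines : ∀ {n} (G H : Graph n) (S : Matrix n) → (Dq G 0# ⊗ S) ≋ (S ⊗ Dq H 0#)
  Dq-0#-intertwines G H S i j = begin
    (Dq G 0# ⊗ S) i j  ≈⟨ sumFin-cong (λ k → *-congʳ (Dq-0#≋I G i k)) ⟩
    (I ⊗ S) i j        ≈⟨ sum-I* i (λ k → S k j) ⟩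
    S i j              ≈⟨ sum-*I j (λ k → S i k) ⟨
    (S ⊗ I) i j        ≈⟨ sumFin-cong (λ k → *-congˡ (Dq-0#≋I H k j)) ⟨
    (S ⊗ Dq H 0#) i j  ∎

  sumFin-isLinearOnPrefix : ∀ {D n} {Φ : Fin n → Seq → Carrier} → (∀ k → IsLinearOnPrefix D (Φ k)) →
                            IsLinearOnPrefix D (λ w → sumFin (λ k → Φ k w))
  sumFin-isLinearOnPrefix {Φ = Φ} Φ-lin =
    isLinearOnPrefix-resp (λ w → reflexive (≡.sym (sumFin≡sum (λ k → Φ k w)))) (sum-isLinearOnPrefix Φ-lin)

  Df⊗-isLinearOnPrefix : ∀ {n} (G : Graph n) (S : Matrix n) i j →
                         IsLinearOnPrefix (suc (maxComponentDiam G)) (λ w → (Df G w ⊗ S) i j)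
  Df⊗-isLinearOnPrefix G S i j =
    sumFin-isLinearOnPrefix (λ k → *ʳ-isLinearOnPrefix (Df-isLinearOnPrefix G i k) (S k j))

  ⊗Df-isLinearOnPrefix : ∀ {n} (H : Graph n) (S : Matrix n) i j →
                         IsLinearOnPrefix (suc (maxComponentDiam H)) (λ w → (S ⊗ Df H w) i j)
  ⊗Df-isLinearOnPrefix H S i j =
    sumFin-isLinearOnPrefix (λ k → *ˡ-isLinearOnPrefix (S i k) (Df-isLinearOnPrefix H k j))

theorem4p1 : ∀ {c ℓ} (F : Field c ℓ) → let open Field F in let open Matrices F in
    ∀ {n : ℕ} (G H : Graph n) (S : Matrix n) → Invertible S →
    (qs : Fin (maxComponentDiam G ⊔ maxComponentDiam H) → Carrier) →
    (∀ i j → qs i ≈ qs j → i ≡ j) →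
    (∀ i → ¬ (qs i ≈ 0#)) →
    (∀ i → (Dq G (qs i) ⊗ S) ≋ (S ⊗ Dq H (qs i))) →
    ∀ (f : ℕ → Carrier) → (Df G f ⊗ S) ≋ (S ⊗ Df H f)
-- Invertibility of S is only needed to pass from the intertwining to cospectrality.
theorem4p1 F G H S _ qs qs-injective qs≉0 intertwine f i j =
  agree-on-powers⇒agree (suc D) (injective-∷ qs≉0 (qs-injective _ _))
    (isLinearOnPrefix-mono (s≤s (m≤m⊔n _ _)) (Df⊗-isLinearOnPrefix G S i j))
    (isLinearOnPrefix-mono (s≤s (m≤n⊔m _ _)) (⊗Df-isLinearOnPrefix H S i j))
    agree-on-powers f
  where
  open Field F hiding (zero)
  open Matrices F
  open Sequences F
  open DistanceMatrices F

  D : ℕ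
  D = maxComponentDiam G ⊔ maxComponentDiam H

  agree-on-powers : ∀ k → (Dq G ((0# ∷ qs) k) ⊗ S) i j ≈ (S ⊗ Dq H ((0# ∷ qs) k)) i j
  agree-on-powers zero    = Dq-0#-intertwines G H S i j
  agree-on-powers (suc k) = intertwine k i j
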